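{- Work in Bishop-style constructive mathematics (BISH). Suppose that the formula $\varphi$ is conditionally constructive. Then for every formula $\psi$, $(\varphi\Rightarrow\lnot\psi)\Rightarrow\lnot\psi$.
   Context: All reasoning is constructive (intuitionistic logic). $I_k=\{1,\dots,k\}$. A subset $M$ of a set $N$ is detachable from $N$ if $\forall x\in N\,(x\in M\lor x\notin M)$. A formula $\varphi$ is conditionally constructive if there exist $k\in\mathbb{N}$ and a subset $M\subseteq I_k$ such that the detachability of $M$ from $I_k$ implies $\varphi$. -}

module Defs where

open import Data.Nat using (ℕ)
open import Data.Fin using (Fin)
open import Data.Sum using (_⊎_)
open import Data.Product using (Σ)
open import Relation.Nullary using (¬_)

-- I_k = {1,…,k} is represented by Fin k (a set with exactly k elements).
I : ℕ → Set
I k = Fin k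

Subset : Set → Set₁
Subset N = N → Set

Detachable : {N : Set} → Subset N → Set
Detachable {N} M = (x : N) → M x ⊎ ¬ M x

ConditionallyConstructive : Set → Set₁
ConditionallyConstructive φ = Σ ℕ (λ k → Σ (Subset (I k)) (λ M → Detachable M → φ))

module Submission where

open import Defs
open import Data.Product using (_,_)
open import Data.Fin.Properties using (sequence)
open import Effect.Monad using (RawMonad)
open import Relation.Nullary using (¬_)
open import Relation.Nullary.Decidable using (toSum; ¬¬-excluded-middle)
open import Relation.Nullary.Negation using (DoubleNegation; ¬¬-Monad; ¬¬-map)

-- Each point of I k is ¬¬-decided in M, and over a finite index set double
-- negation commutes with the universal quantifier.
¬¬-detachable : ∀ {k} (M : Subset (I k)) → DoubleNegation (Detachable M)
¬¬-detachable M =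
  ¬¬-map (λ dec x → toSum (dec x))
    (sequence (RawMonad.rawApplicative ¬¬-Monad) (λ _ → ¬¬-excluded-middle))

conditionallyConstructive⇒¬¬ : ∀ {φ} → ConditionallyConstructive φ → DoubleNegation φ
conditionallyConstructive⇒¬¬ (k , M , detachable⇒φ) =
  ¬¬-map detachable⇒φ (¬¬-detachable M)

proposition6 : (φ : Set) → ConditionallyConstructive φ → (ψ : Set) → (φ → ¬ ψ) → ¬ ψ
proposition6 φ cc ψ φ⇒¬ψ ψ-holds =
  conditionallyConstructive⇒¬¬ cc (λ φ-holds → φ⇒¬ψ φ-holds ψ-holds)
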